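{- Let $n\ge1$, let $M:S_n\to S_n$ be a max shuffle, and let $w\in S_n$ with $w\notin U_n$. Then $M$ sorts $w$, i.e. $M^m(w)=\varepsilon$ for some $m\in\mathbb{N}$.
   Context: $[n]=\{1,\dots,n\}$, $[a,b]=\{a,a+1,\dots,b\}$; $S_n$ is the group of bijections $[n]\to[n]$ with product $(ab)(i)=a(b(i))$ and identity $\varepsilon$. A homing shuffle is a map $F:S_n\to S_n$ such that for every $w\in S_n$, setting $k:=w(1)$: (a) $F(w)(k)=k$, and (b) $F(w)(i)=w(i)$ for all $i>k$. A max shuffle is a homing shuffle $M$ such that for every $w\in S_n$ with $w(1)\neq1$, $M(w)(1)=\max(w([2,k]))$ where $k=w(1)$. $M^m$ is the $m$-th iterate. For $w\in S_n$, $i_w$ is the smallest $k\in[n]$ with $w([k])=[k]$, and $U_n:=\{w\in S_n : \text{there is } i>i_w \text{ with } w(i)\neq i\}$. -}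

module Defs where

open import Data.Nat as ℕ using (ℕ; zero; suc)
open import Data.Fin as Fin using (Fin; toℕ)
open import Data.Fin.Permutation using (Permutation′; _⟨$⟩ʳ_)
open import Data.Product using (Σ; ∃; _×_)
open import Relation.Binary.PropositionalEquality using (_≡_; _≢_)
open import Data.Empty using (⊥)

-- Convention: S_n is modelled as Permutation′ n (bijections Fin n ↔ Fin n).
-- Positions/values are 0-based: paper's position p ∈ [n] is the Fin element
-- with toℕ = p - 1.  Equality of permutations is pointwise.

iter : ∀ {A : Set} → ℕ → (A → A) → A → A
iter zero    f x = x
iter (suc m) f x = f (iter m f x)

IsIdentity : ∀ {n} → Permutation′ n → Set
IsIdentity w = ∀ i → w ⟨$⟩ʳ i ≡ i

-- Homing shuffle on S_{suc n} (so that position 1, i.e. index 0, exists).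
-- k := w(1) (index w ⟨$⟩ʳ 0);  (a) F(w)(k) = k;  (b) F(w)(i) = w(i) for i > k.
IsHomingShuffle : ∀ {n} → (Permutation′ (suc n) → Permutation′ (suc n)) → Set
IsHomingShuffle {n} F =
  ∀ (w : Permutation′ (suc n)) →
    (F w ⟨$⟩ʳ (w ⟨$⟩ʳ Fin.zero) ≡ w ⟨$⟩ʳ Fin.zero)
    × (∀ i → toℕ (w ⟨$⟩ʳ Fin.zero) ℕ.< toℕ i → F w ⟨$⟩ʳ i ≡ w ⟨$⟩ʳ i)

-- x is the maximum of the set w([2,k]) (1-based), i.e. of
-- { w(j) : 1 ≤ toℕ j ≤ toℕ (w 0) } in 0-based indexing.
IsMaxOfInterval : ∀ {n} → Permutation′ (suc n) → Fin (suc n) → Set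
IsMaxOfInterval {n} w x =
  (∃ λ (j : Fin (suc n)) → (1 ℕ.≤ toℕ j) × (toℕ j ℕ.≤ toℕ (w ⟨$⟩ʳ Fin.zero)) × (w ⟨$⟩ʳ j ≡ x))
  × (∀ (j : Fin (suc n)) → 1 ℕ.≤ toℕ j → toℕ j ℕ.≤ toℕ (w ⟨$⟩ʳ Fin.zero) → w ⟨$⟩ʳ j Fin.≤ x)

IsMaxShuffle : ∀ {n} → (Permutation′ (suc n) → Permutation′ (suc n)) → Set
IsMaxShuffle {n} M =
  IsHomingShuffle M
  × (∀ (w : Permutation′ (suc n)) → w ⟨$⟩ʳ Fin.zero ≢ Fin.zero →
       IsMaxOfInterval w (M w ⟨$⟩ʳ Fin.zero))

-- w([k]) = [k]  (k a natural number, [k] = 1-based {1..k} = 0-based indices with toℕ < k)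
FixesPrefix : ∀ {n} → Permutation′ n → ℕ → Set
FixesPrefix {n} w k =
  (∀ (j : Fin n) → toℕ j ℕ.< k → toℕ (w ⟨$⟩ʳ j) ℕ.< k)
  × (∀ (v : Fin n) → toℕ v ℕ.< k → ∃ λ (j : Fin n) → (toℕ j ℕ.< k) × (w ⟨$⟩ʳ j ≡ v))

IsIw : ∀ {n} → Permutation′ n → ℕ → Set
IsIw {n} w k =
  (1 ℕ.≤ k) × (k ℕ.≤ n) × FixesPrefix w k
  × (∀ k′ → 1 ℕ.≤ k′ → k′ ℕ.< k → FixesPrefix w k′ → ⊥)

-- w ∈ U_n : there is a (1-based) position i > i_w with w(i) ≠ i.
-- 1-based position i > k  ⟺  0-based index with toℕ ≥ k.
InU : ∀ {n} → Permutation′ n → Set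
InU {n} w = ∃ λ k → IsIw w k × (∃ λ (i : Fin n) → (k ℕ.≤ toℕ i) × (w ⟨$⟩ʳ i ≢ i))

-- Say the cut after position j is crossed by w if some position a ≤ j is sent beyond j.
-- For w ∉ U_n every cut below a moved position is crossed, and a max shuffle preserves
-- this: M(w)(1) = max w([2,k]) is large enough to cross every cut below k, positions
-- above k are untouched, and k becomes fixed.  Reading the set of moved positions as
-- the binary digits of a number, M therefore strictly decreases it: the highest changed
-- digit (position k) drops from 1 to 0.  Once w(1) = 1, the crossing property forces
-- every position to be fixed.
module Submission where

open import Defs
open import Data.Nat using (ℕ; zero; suc; _+_; _*_; _^_; _≤_; _<_; z≤n; s≤s; _<?_; _≤?_)
open import Data.Nat.Properties
open import Data.Fin as Fin using (Fin; toℕ; fromℕ; fromℕ<; inject≤; lower)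
open import Data.Fin.Properties as Finₚ
  using ( toℕ<n; toℕ-fromℕ<; fromℕ<-toℕ; toℕ-fromℕ; toℕ-inject; toℕ-inject≤; toℕ-injective
        ; inject≤-injective; lower-injective; injective⇒≤; injective⇒existsPivot
        ; ¬∀⟶∃¬-smallest; any?; all?)
  renaming (_≟_ to _≟ᶠ_)
open import Data.Fin.Permutation using (Permutation′; _⟨$⟩ʳ_; _⟨$⟩ˡ_; inverseʳ)
open import Data.Product using (∃; _×_; _,_; proj₁; proj₂)
open import Data.Sum using (inj₁; inj₂)
open import Data.Empty using (⊥-elim)
open import Function.Base using (_∘_)
open import Function.Bundles using (Injection)
open import Function.Definitions using (Injective)
open import Function.Properties.Inverse using (↔⇒↣)
open import Relation.Nullary using (¬_; Dec; yes; no)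
open import Relation.Nullary.Decidable using (¬?; _×-dec_; _→-dec_; decidable-stable)
open import Relation.Binary using (tri<; tri≈; tri>)
open import Relation.Binary.PropositionalEquality

iter-suc′ : ∀ {A : Set} (f : A → A) m x → iter m f (f x) ≡ iter (suc m) f x
iter-suc′ f zero    x = refl
iter-suc′ f (suc m) x = cong f (iter-suc′ f m x)

least-witness : ∀ {P : ℕ → Set} → (∀ k → Dec (P k)) → ∀ {m} → P m →
                ∃ λ k → k ≤ m × P k × (∀ {j} → j < k → ¬ P j)
least-witness {P} P? {m} pm
  with i , ¬¬Pi , below ← ¬∀⟶∃¬-smallest (suc m) (λ i → ¬ P (toℕ i)) (λ i → ¬? (P? (toℕ i)))
                            (λ ¬P → ¬P (fromℕ m) (subst P (sym (toℕ-fromℕ m)) pm))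
  = toℕ i , ≤-pred (toℕ<n i) , decidable-stable (P? (toℕ i)) ¬¬Pi
  , λ j<i Pj → below (fromℕ< j<i) (subst P (sym (trans (toℕ-inject _) (toℕ-fromℕ< j<i))) Pj)

injective⇒≤-bound : ∀ {c m N} {f : Fin c → Fin N} → Injective _≡_ _≡_ f →
                    (∀ b → toℕ (f b) < m) → c ≤ m
injective⇒≤-bound {f = f} f-injective f<m =
  injective⇒≤ {f = λ b → lower (f b) (f<m b)} (f-injective ∘ lower-injective _ _)

binary : (ℕ → ℕ) → ℕ → ℕ
binary f zero    = 0
binary f (suc c) = binary f c + f c * 2 ^ c

binary<2^ : ∀ {f} → (∀ i → f i ≤ 1) → ∀ c → binary f c < 2 ^ c
binary<2^ f≤1 zero    = s≤s z≤n
binary<2^ {f} f≤1 (suc c) = begin-strict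
  binary f c + f c * 2 ^ c  <⟨ +-monoˡ-< (f c * 2 ^ c) (binary<2^ f≤1 c) ⟩
  2 ^ c + f c * 2 ^ c       ≤⟨ +-monoʳ-≤ (2 ^ c) (*-monoˡ-≤ (2 ^ c) (f≤1 c)) ⟩
  2 ^ c + 1 * 2 ^ c         ∎
  where open ≤-Reasoning

binary-< : ∀ {f g k} → (∀ i → g i ≤ 1) → (∀ i → k < i → g i ≡ f i) → g k < f k →
           ∀ c → k < c → binary g c < binary f c
binary-< {f} {g} {k} g≤1 agree gk<fk (suc c) (s≤s k≤c) with m≤n⇒m<n∨m≡n k≤c
... | inj₁ k<c rewrite agree c k<c =
  +-monoˡ-< (f c * 2 ^ c) (binary-< g≤1 agree gk<fk c k<c)
... | inj₂ refl = begin-strict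
  binary g k + g k * 2 ^ k  <⟨ +-monoˡ-< (g k * 2 ^ k) (binary<2^ g≤1 k) ⟩
  suc (g k) * 2 ^ k         ≤⟨ *-monoˡ-≤ (2 ^ k) gk<fk ⟩
  f k * 2 ^ k               ≤⟨ m≤n+m (f k * 2 ^ k) (binary f k) ⟩
  binary f k + f k * 2 ^ k  ∎
  where open ≤-Reasoning

module _ {N : ℕ} where

  extend : (Fin N → ℕ) → ℕ → ℕ
  extend f i with i <? N
  ... | yes i<N = f (fromℕ< i<N)
  ... | no _    = 0

  extend-toℕ : ∀ f (x : Fin N) → extend f (toℕ x) ≡ f x
  extend-toℕ f x with toℕ x <? N
  ... | yes x<N = cong f (fromℕ<-toℕ x x<N)
  ... | no x≮N  = ⊥-elim (x≮N (toℕ<n x))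

  extend-≤ : ∀ {f b} → (∀ x → f x ≤ b) → ∀ i → extend f i ≤ b
  extend-≤ f≤b i with i <? N
  ... | yes i<N = f≤b (fromℕ< i<N)
  ... | no _    = z≤n

  extend-cong-above : ∀ {f g k} → (∀ x → k < toℕ x → f x ≡ g x) →
                      ∀ i → k < i → extend f i ≡ extend g i
  extend-cong-above {k = k} f≡g i k<i with i <? N
  ... | yes i<N = f≡g (fromℕ< i<N) (subst (k <_) (sym (toℕ-fromℕ< i<N)) k<i)
  ... | no _    = refl

  ⟨$⟩ʳ-injective : (w : Permutation′ N) → Injective _≡_ _≡_ (w ⟨$⟩ʳ_)
  ⟨$⟩ʳ-injective w = Injection.injective (↔⇒↣ w)

  moved : Permutation′ N → Fin N → ℕ
  moved w x with w ⟨$⟩ʳ x ≟ᶠ x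
  ... | yes _ = 0
  ... | no _  = 1

  moved≤1 : ∀ w x → moved w x ≤ 1
  moved≤1 w x with w ⟨$⟩ʳ x ≟ᶠ x
  ... | yes _ = z≤n
  ... | no _  = ≤-refl

  moved-fixed : ∀ {w x} → w ⟨$⟩ʳ x ≡ x → moved w x ≡ 0
  moved-fixed {w} {x} fixed with w ⟨$⟩ʳ x ≟ᶠ x
  ... | yes _      = refl
  ... | no unfixed = ⊥-elim (unfixed fixed)

  moved-unfixed : ∀ {w x} → w ⟨$⟩ʳ x ≢ x → moved w x ≡ 1
  moved-unfixed {w} {x} unfixed with w ⟨$⟩ʳ x ≟ᶠ x
  ... | yes fixed = ⊥-elim (unfixed fixed)
  ... | no _      = refl

  moved-cong : ∀ {w w′ x} → w ⟨$⟩ʳ x ≡ w′ ⟨$⟩ʳ x → moved w x ≡ moved w′ x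
  moved-cong {w} {w′} {x} w≡w′ with w′ ⟨$⟩ʳ x ≟ᶠ x
  ... | yes fixed   = moved-fixed (trans w≡w′ fixed)
  ... | no unfixed  = moved-unfixed (unfixed ∘ trans (sym w≡w′))

  potential : Permutation′ N → ℕ
  potential w = binary (extend (moved w)) N

  potential-< : ∀ {w w′ : Permutation′ N} {k} → w′ ⟨$⟩ʳ k ≡ k → w ⟨$⟩ʳ k ≢ k →
                (∀ x → toℕ k < toℕ x → w′ ⟨$⟩ʳ x ≡ w ⟨$⟩ʳ x) → potential w′ < potential w
  potential-< {w} {w′} {k} fixed′ unfixed agree =
    binary-< (extend-≤ (moved≤1 w′)) (extend-cong-above (λ x k<x → moved-cong (agree x k<x)))
             digit-k N (toℕ<n k)
    where
    open ≤-Reasoning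
    digit-k : extend (moved w′) (toℕ k) < extend (moved w) (toℕ k)
    digit-k = begin-strict
      extend (moved w′) (toℕ k)  ≡⟨ trans (extend-toℕ (moved w′) k) (moved-fixed fixed′) ⟩
      0                          <⟨ s≤s z≤n ⟩
      1                          ≡⟨ sym (trans (extend-toℕ (moved w) k) (moved-unfixed unfixed)) ⟩
      extend (moved w) (toℕ k)   ∎

  Closed : Permutation′ N → ℕ → Set
  Closed w c = ∀ a → toℕ a < c → toℕ (w ⟨$⟩ʳ a) < c

  Crossed : Permutation′ N → ℕ → Set
  Crossed w j = ∃ λ a → toℕ a ≤ j × j < toℕ (w ⟨$⟩ʳ a)

  CrossedBelowMoved : Permutation′ N → Set
  CrossedBelowMoved w = ∀ i j → j < toℕ i → w ⟨$⟩ʳ i ≢ i → Crossed w j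

  closed? : ∀ w c → Dec (Closed w c)
  closed? w c = all? (λ a → (toℕ a <? c) →-dec (toℕ (w ⟨$⟩ʳ a) <? c))

  crossed? : ∀ w j → Dec (Crossed w j)
  crossed? w j = any? (λ a → (toℕ a ≤? j) ×-dec (j <? toℕ (w ⟨$⟩ʳ a)))

  ¬crossed⇒closed : ∀ {w j} → ¬ Crossed w j → Closed w (suc j)
  ¬crossed⇒closed ¬crossed a (s≤s a≤j) = s≤s (≮⇒≥ (λ j<wa → ¬crossed (a , a≤j , j<wa)))

  closed⇒onto : ∀ w {c} → c ≤ N → Closed w c →
                ∀ v → toℕ v < c → ∃ λ a → toℕ a < c × w ⟨$⟩ʳ a ≡ v
  closed⇒onto w {c} c≤N closed v v<c with toℕ (w ⟨$⟩ˡ v) <? c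
  ... | yes pre<c = w ⟨$⟩ˡ v , pre<c , inverseʳ w
  ... | no pre≮c  = ⊥-elim (1+n≰n (injective⇒≤-bound (g-injective ∘ ⟨$⟩ʳ-injective w) wg<c))
    where
    -- c + 1 distinct positions, all sent below c
    g : Fin (suc c) → Fin N
    g Fin.zero    = w ⟨$⟩ˡ v
    g (Fin.suc b) = inject≤ b c≤N

    inject≤≢pre : ∀ b → inject≤ b c≤N ≢ w ⟨$⟩ˡ v
    inject≤≢pre b b≡pre = pre≮c (subst (_< c) (trans (sym (toℕ-inject≤ b c≤N)) (cong toℕ b≡pre))
                                       (toℕ<n b))

    g-injective : Injective _≡_ _≡_ g
    g-injective {Fin.zero}  {Fin.zero}   _ = refl
    g-injective {Fin.zero}  {Fin.suc b}  e = ⊥-elim (inject≤≢pre b (sym e))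
    g-injective {Fin.suc b} {Fin.zero}   e = ⊥-elim (inject≤≢pre b e)
    g-injective {Fin.suc b} {Fin.suc b′} e = cong Fin.suc (inject≤-injective c≤N c≤N b b′ e)

    wg<c : ∀ b → toℕ (w ⟨$⟩ʳ g b) < c
    wg<c Fin.zero    = subst (λ x → toℕ x < c) (sym (inverseʳ w)) v<c
    wg<c (Fin.suc b) = closed (inject≤ b c≤N) (subst (_< c) (sym (toℕ-inject≤ b c≤N)) (toℕ<n b))

  closed⇒iw : ∀ w {c} → suc c ≤ N → Closed w (suc c) → ∃ λ k → IsIw w k × k ≤ suc c
  closed⇒iw w {c} sc≤N closed
    with c₀ , c₀≤c , closed₀ , below ← least-witness (λ c′ → closed? w (suc c′)) closed
    = suc c₀
    , ( s≤s z≤n , sc₀≤N , (closed₀ , closed⇒onto w sc₀≤N closed₀)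
      , λ { (suc k) _ (s≤s k<c₀) fixes → below k<c₀ (proj₁ fixes) })
    , s≤s c₀≤c
    where
    sc₀≤N : suc c₀ ≤ N
    sc₀≤N = ≤-trans (s≤s c₀≤c) sc≤N

  ¬InU⇒crossedBelowMoved : ∀ w → ¬ InU w → CrossedBelowMoved w
  ¬InU⇒crossedBelowMoved w w∉U i j j<i unfixed with crossed? w j
  ... | yes crossed = crossed
  ... | no ¬crossed
    with k , iw , k≤sj ← closed⇒iw w (≤-trans j<i (<⇒≤ (toℕ<n i))) (¬crossed⇒closed {w} ¬crossed)
    = ⊥-elim (w∉U (k , iw , i , ≤-trans k≤sj j<i , unfixed))

permutation-pivot : ∀ {n} (w : Permutation′ (suc n)) {j} (j<n : j < n) →
                    ∃ λ b → toℕ b ≤ j × j ≤ toℕ (w ⟨$⟩ʳ Fin.suc b)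
permutation-pivot w j<n
  with b , b≤j , j≤wb ← injective⇒existsPivot {f = λ b → w ⟨$⟩ʳ Fin.suc b}
                          (Finₚ.suc-injective ∘ ⟨$⟩ʳ-injective w) (fromℕ< j<n)
  = b , subst (toℕ b ≤_) (toℕ-fromℕ< j<n) b≤j , subst (_≤ toℕ (w ⟨$⟩ʳ Fin.suc b)) (toℕ-fromℕ< j<n) j≤wb

crossedBelowMoved⇒identity : ∀ {n} (w : Permutation′ (suc n)) → CrossedBelowMoved w →
                             w ⟨$⟩ʳ Fin.zero ≡ Fin.zero → IsIdentity w
crossedBelowMoved⇒identity w crossed w0≡0 Fin.zero = w0≡0
crossedBelowMoved⇒identity w crossed w0≡0 (Fin.suc i) with w ⟨$⟩ʳ Fin.suc i ≟ᶠ Fin.suc i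
... | yes fixed = fixed
... | no unfixed with crossed (Fin.suc i) 0 (s≤s z≤n) unfixed
...   | Fin.zero , _ , 0<w0 = ⊥-elim (<-irrefl refl (subst (λ x → 0 < toℕ x) w0≡0 0<w0))

module MaxShuffleStep {n} (M : Permutation′ (suc n) → Permutation′ (suc n)) (isMax : IsMaxShuffle M)
                      (w : Permutation′ (suc n)) (w0≢0 : w ⟨$⟩ʳ Fin.zero ≢ Fin.zero) where

  k : Fin (suc n)
  k = w ⟨$⟩ʳ Fin.zero

  homes : M w ⟨$⟩ʳ k ≡ k
  homes = proj₁ (proj₁ isMax w)

  keeps-above : ∀ i → toℕ k < toℕ i → M w ⟨$⟩ʳ i ≡ w ⟨$⟩ʳ i
  keeps-above = proj₂ (proj₁ isMax w)

  crossed-via-max : ∀ {j} b → 1 ≤ toℕ b → toℕ b ≤ toℕ k → j < toℕ (w ⟨$⟩ʳ b) → Crossed (M w) j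
  crossed-via-max b 1≤b b≤k j<wb =
    Fin.zero , z≤n , <-≤-trans j<wb (proj₂ (proj₂ isMax w w0≢0) b 1≤b b≤k)

  crossed-low : ∀ {j} → suc j < toℕ k → Crossed (M w) j
  crossed-low {j} sj<k
    with b , b≤sj , sj≤wb ← permutation-pivot w (<-≤-trans sj<k (≤-pred (toℕ<n k)))
    = crossed-via-max (Fin.suc b) (s≤s z≤n) (≤-trans (s≤s b≤sj) sj<k) sj≤wb

  crossed-below : ∀ {j} → j < toℕ k → Crossed w (toℕ k) → Crossed (M w) j
  crossed-below j<k (Fin.zero , _ , k<k)         = ⊥-elim (<-irrefl refl k<k)
  crossed-below j<k (a@(Fin.suc _) , a≤k , k<wa) = crossed-via-max a (s≤s z≤n) a≤k (<-trans j<k k<wa)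

  crossed-above : ∀ {j} → toℕ k ≤ j → Crossed w j → Crossed (M w) j
  crossed-above k≤j (Fin.zero , _ , j<k) = ⊥-elim (<⇒≱ j<k k≤j)
  crossed-above {j} k≤j (a@(Fin.suc _) , a≤j , j<wa) with toℕ k <? toℕ a
  ... | yes k<a = a , a≤j , subst (λ x → j < toℕ x) (sym (keeps-above a k<a)) j<wa
  ... | no k≮a  = crossed-via-max a (s≤s z≤n) (≮⇒≥ k≮a) j<wa

  unfixed-above : ∀ i → toℕ k < toℕ i → M w ⟨$⟩ʳ i ≢ i → w ⟨$⟩ʳ i ≢ i
  unfixed-above i k<i unfixed = unfixed ∘ trans (keeps-above i k<i)

  preserves : CrossedBelowMoved w → CrossedBelowMoved (M w)
  preserves crossed i j j<i unfixed with <-cmp (toℕ i) (toℕ k)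
  ... | tri< i<k _ _ = crossed-low (≤-trans (s≤s j<i) i<k)
  ... | tri≈ _ i≡k _ = ⊥-elim (unfixed (subst (λ x → M w ⟨$⟩ʳ x ≡ x) (sym (toℕ-injective i≡k)) homes))
  ... | tri> _ _ k<i with j <? toℕ k
  ...   | yes j<k = crossed-below j<k (crossed i (toℕ k) k<i (unfixed-above i k<i unfixed))
  ...   | no j≮k  = crossed-above (≮⇒≥ j≮k) (crossed i j j<i (unfixed-above i k<i unfixed))

  decreases : potential (M w) < potential w
  decreases = potential-< homes (w0≢0 ∘ ⟨$⟩ʳ-injective w) keeps-above

sorted-within : ∀ {n} (M : Permutation′ (suc n) → Permutation′ (suc n)) → IsMaxShuffle M →
                ∀ bound w → potential w < bound → CrossedBelowMoved w →
                ∃ λ m → IsIdentity (iter m M w)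
sorted-within M isMax (suc bound) w p<bound crossed with w ⟨$⟩ʳ Fin.zero ≟ᶠ Fin.zero
... | yes w0≡0 = 0 , crossedBelowMoved⇒identity w crossed w0≡0
... | no w0≢0
  with m , sorted ← sorted-within M isMax bound (M w)
                      (<-≤-trans (MaxShuffleStep.decreases M isMax w w0≢0) (≤-pred p<bound))
                      (MaxShuffleStep.preserves M isMax w w0≢0 crossed)
  = suc m , subst IsIdentity (iter-suc′ M m w) sorted

theorem5 : (n : ℕ) (M : Permutation′ (suc n) → Permutation′ (suc n)) →
    IsMaxShuffle M → (w : Permutation′ (suc n)) → ¬ InU w →
    ∃ λ (m : ℕ) → IsIdentity (iter m M w)
theorem5 n M isMax w w∉U =
  sorted-within M isMax (suc (potential w)) w ≤-refl (¬InU⇒crossedBelowMoved w w∉U)
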